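{- If $N$ is a normal form, then there exist a basis $\Gamma$, a name context $\Delta$ and a stack type $\kappa$ such that $\Gamma\vdash N:\kappa\to\nu\mid\Delta$ is derivable.
   Context: Pure $\lambda\mu$-calculus: terms $M,N ::= x \mid \lambda x.M \mid MN \mid \mu\alpha.C$, commands $C ::= [\alpha]M$, over disjoint denumerable sets of term variables and names; $\lambda$ binds $x$, $\mu$ binds $\alpha$. Normal forms are the terms generated by $N ::= xN_1\cdots N_k \ (k\ge 0) \mid \lambda x.N \mid \mu\alpha.[\beta]N$. Types: with a single constant $\nu$ and a symbol $\omega$ (not itself a type), term types $\delta ::= \nu \mid \omega\to\nu \mid \kappa\to\nu \mid \delta\wedge\delta$ and stack types $\kappa ::= \delta\times\omega \mid \delta\times\kappa \mid \kappa\wedge\kappa$. The preorder $\le$ is the least preorder with: $\sigma\wedge\tau\le\sigma$; $\sigma\wedge\tau\le\tau$; $\nu\le\omega\to\nu$; $\omega\to\nu\le\nu$; $\delta_1\times\delta_2\times\omega\le\delta_1\times\omega$; $(\delta_1\times\omega)\wedge(\delta_2\times\kappa)\le(\delta_1\wedge\delta_2)\times\kappa$; $(\delta_1\times\kappa_1)\wedge(\delta_2\times\kappa_2)\le(\delta_1\wedge\delta_2)\times(\kappa_1\wedge\kappa_2)$; $\delta_1\le\delta_2\Rightarrow\delta_1\times\omega\le\delta_2\times\omega$; $\delta_1\le\delta_2,\kappa_1\le\kappa_2\Rightarrow\delta_1\times\kappa_1\le\delta_2\times\kappa_2$; $\sigma\le\tau_1,\sigma\le\tau_2\Rightarrow\sigma\le\tau_1\wedge\tau_2$;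 $\kappa_2\le\kappa_1\Rightarrow\kappa_1\to\nu\le\kappa_2\to\nu$. Bases $\Gamma$ map finitely many term variables to term types; name contexts $\Delta$ map finitely many names to stack types; comma = disjoint extension. Typing rules: (ax) $\Gamma,x{:}\delta\vdash x:\delta\mid\Delta$; (abs) from $\Gamma,x{:}\delta\vdash M:\kappa\to\nu\mid\Delta$ infer $\Gamma\vdash\lambda x.M:\delta\times\kappa\to\nu\mid\Delta$; (app) from $\Gamma\vdash M:\delta\times\kappa\to\nu\mid\Delta$ and $\Gamma\vdash N:\delta\mid\Delta$ infer $\Gamma\vdash MN:\kappa\to\nu\mid\Delta$ ($\kappa$ a stack type or $\omega$ in (abs), (app)); ($\mu$) from $\Gamma\vdash M:\kappa\to\nu\mid\alpha{:}\kappa,\Delta$ infer $\Gamma\vdash\mu\alpha.[\alpha]M:\kappa\to\nu\mid\Delta$, and for $\alpha\ne\beta$ from $\Gamma\vdash M:\kappa'\to\nu\mid\alpha{:}\kappa,\beta{:}\kappa',\Delta$ infer $\Gamma\vdash\mu\alpha.[\beta]M:\kappa\to\nu\mid\beta{:}\kappa',\Delta$; ($\le$) from $\Gamma\vdash M:\delta\mid\Delta$ and $\delta\le\delta'$ infer $\Gamma\vdash M:\delta'\mid\Delta$; ($\wedge$) from $\Gamma\vdash M:\delta\mid\Delta$ and $\Gamma\vdash M:\delta'\mid\Delta$ infer $\Gamma\vdash M:\delta\wedge\delta'\mid\Delta$. Variables in $\Gamma$ and names in $\Delta$ are not bound in the typed term. -}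

module Defs where

open import Data.Nat using (ℕ; suc)
open import Data.Fin using (Fin; zero; suc)
open import Data.Vec using (Vec; _∷_; lookup)

-- Term n m : terms whose free term variables are among n (Fin n) and
-- whose free names are among m (Fin m).  λ binds term variable 0,
-- μ binds name 0.

mutual
  data Term (n m : ℕ) : Set where
    var : Fin n → Term n m
    lam : Term (suc n) m → Term n m
    app : Term n m → Term n m → Term n m
    mu  : Cmd n (suc m) → Term n m

  data Cmd (n m : ℕ) : Set where
    [_]_ : Fin m → Term n m → Cmd n m

mutual
  data Neutral {n m : ℕ} : Term n m → Set where
    var : (x : Fin n) → Neutral (var x)
    app : {M N : Term n m} → Neutral M → Normal N → Neutral (app M N)

  data Normal {n m : ℕ} : Term n m → Set where
    ne  : {M : Term n m} → Neutral M → Normal M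
    lam : {M : Term (suc n) m} → Normal M → Normal (lam M)
    mu  : {β : Fin (suc m)} {M : Term n (suc m)} → Normal M → Normal (mu ([ β ] M))

-- Types.
--   term types   δ ::= ν | ω→ν | κ→ν | δ∧δ
--   stack types  κ ::= δ×ω | δ×κ | κ∧κ
-- SO is "a stack type or ω".

mutual
  data TType : Set where
    ν    : TType
    _⇒ν  : SO → TType
    _∧_  : TType → TType → TType

  data SType : Set where
    _×ₛ_ : TType → SO → SType
    _∧ₛ_ : SType → SType → SType

  data SO : Set where
    ω   : SO
    ⌜_⌝ : SType → SO

infixr 8 _×ₛ_
infixl 7 _∧_ _∧ₛ_

mutual
  data _≤T_ : TType → TType → Set where
    reflT  : ∀ {σ} → σ ≤T σ
    transT : ∀ {σ τ ρ} → σ ≤T τ → τ ≤T ρ → σ ≤T ρ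
    ∧-lbT  : ∀ {σ τ} → (σ ∧ τ) ≤T σ
    ∧-rbT  : ∀ {σ τ} → (σ ∧ τ) ≤T τ
    ν≤ων   : ν ≤T (ω ⇒ν)
    ων≤ν   : (ω ⇒ν) ≤T ν
    glbT   : ∀ {σ τ₁ τ₂} → σ ≤T τ₁ → σ ≤T τ₂ → σ ≤T (τ₁ ∧ τ₂)
    contra : ∀ {κ₁ κ₂} → κ₂ ≤S κ₁ → (⌜ κ₁ ⌝ ⇒ν) ≤T (⌜ κ₂ ⌝ ⇒ν)

  data _≤S_ : SType → SType → Set where
    reflS  : ∀ {σ} → σ ≤S σ
    transS : ∀ {σ τ ρ} → σ ≤S τ → τ ≤S ρ → σ ≤S ρ
    ∧-lbS  : ∀ {σ τ} → (σ ∧ₛ τ) ≤S σ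
    ∧-rbS  : ∀ {σ τ} → (σ ∧ₛ τ) ≤S τ
    glbS   : ∀ {σ τ₁ τ₂} → σ ≤S τ₁ → σ ≤S τ₂ → σ ≤S (τ₁ ∧ₛ τ₂)
    drop   : ∀ {δ₁ δ₂} → (δ₁ ×ₛ ⌜ δ₂ ×ₛ ω ⌝) ≤S (δ₁ ×ₛ ω)
    distω  : ∀ {δ₁ δ₂ κ} → ((δ₁ ×ₛ ω) ∧ₛ (δ₂ ×ₛ ⌜ κ ⌝)) ≤S ((δ₁ ∧ δ₂) ×ₛ ⌜ κ ⌝)
    dist   : ∀ {δ₁ δ₂ κ₁ κ₂} →
             ((δ₁ ×ₛ ⌜ κ₁ ⌝) ∧ₛ (δ₂ ×ₛ ⌜ κ₂ ⌝)) ≤S ((δ₁ ∧ δ₂) ×ₛ ⌜ κ₁ ∧ₛ κ₂ ⌝)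
    monoω  : ∀ {δ₁ δ₂} → δ₁ ≤T δ₂ → (δ₁ ×ₛ ω) ≤S (δ₂ ×ₛ ω)
    mono   : ∀ {δ₁ δ₂ κ₁ κ₂} → δ₁ ≤T δ₂ → κ₁ ≤S κ₂ →
             (δ₁ ×ₛ ⌜ κ₁ ⌝) ≤S (δ₂ ×ₛ ⌜ κ₂ ⌝)

data _⊢_∶_∣_ {n m : ℕ} (Γ : Vec TType n) : Term n m → TType → Vec SType m → Set where
  ax   : ∀ {Δ} (x : Fin n) → Γ ⊢ var x ∶ lookup Γ x ∣ Δ
  abs  : ∀ {Δ δ} {κ : SO} {M : Term (suc n) m} →
         (δ ∷ Γ) ⊢ M ∶ κ ⇒ν ∣ Δ → Γ ⊢ lam M ∶ ⌜ δ ×ₛ κ ⌝ ⇒ν ∣ Δ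
  app  : ∀ {Δ δ} {κ : SO} {M N : Term n m} →
         Γ ⊢ M ∶ ⌜ δ ×ₛ κ ⌝ ⇒ν ∣ Δ → Γ ⊢ N ∶ δ ∣ Δ → Γ ⊢ app M N ∶ κ ⇒ν ∣ Δ
  mu₁  : ∀ {Δ κ} {M : Term n (suc m)} →
         Γ ⊢ M ∶ ⌜ κ ⌝ ⇒ν ∣ (κ ∷ Δ) → Γ ⊢ mu ([ zero ] M) ∶ ⌜ κ ⌝ ⇒ν ∣ Δ
  -- μα.[β]M with β ≠ α, where β : κ' in Δ
  mu₂  : ∀ {Δ κ} {β : Fin m} {M : Term n (suc m)} →
         Γ ⊢ M ∶ ⌜ lookup Δ β ⌝ ⇒ν ∣ (κ ∷ Δ) → Γ ⊢ mu ([ suc β ] M) ∶ ⌜ κ ⌝ ⇒ν ∣ Δ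
  sub  : ∀ {Δ δ δ'} {M : Term n m} → Γ ⊢ M ∶ δ ∣ Δ → δ ≤T δ' → Γ ⊢ M ∶ δ' ∣ Δ
  int  : ∀ {Δ δ δ'} {M : Term n m} → Γ ⊢ M ∶ δ ∣ Δ → Γ ⊢ M ∶ δ' ∣ Δ → Γ ⊢ M ∶ (δ ∧ δ') ∣ Δ

-- A neutral term x N₁ ⋯ Nₖ can be given every type ρ → ν: type the arguments
-- first and then choose the type of the head x accordingly.  Derivations of
-- subterms are joined by meeting their bases and name contexts pointwise,
-- since typing is antitone in both.  For μα.[β]M, every name is met with the
-- stack type κ of M, so that the type of β lies below κ and contravariance of
-- κ → ν retypes M at the type required by the (μ) rule.
module Submission where

open import Defs
open import Data.Nat using (ℕ; suc)
open import Data.Fin using (Fin; zero; suc)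
open import Data.Vec using (Vec; _∷_; lookup; map; replicate; zipWith)
open import Data.Vec.Properties using (lookup-map; lookup-replicate; lookup-zipWith)
open import Data.Product using (∃-syntax; _,_)
open import Relation.Binary.PropositionalEquality using (subst)

private
  variable
    n m : ℕ

_≤ᴮ_ : Vec TType n → Vec TType n → Set
Γ' ≤ᴮ Γ = ∀ i → lookup Γ' i ≤T lookup Γ i

_≤ᴺ_ : Vec SType m → Vec SType m → Set
Δ' ≤ᴺ Δ = ∀ i → lookup Δ' i ≤S lookup Δ i

≤ᴮ-refl : (Γ : Vec TType n) → Γ ≤ᴮ Γ
≤ᴮ-refl Γ i = reflT

≤ᴮ-∷ : ∀ δ {Γ' Γ : Vec TType n} → Γ' ≤ᴮ Γ → (δ ∷ Γ') ≤ᴮ (δ ∷ Γ)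
≤ᴮ-∷ δ Γ'≤Γ zero    = reflT
≤ᴮ-∷ δ Γ'≤Γ (suc i) = Γ'≤Γ i

≤ᴺ-∷ : ∀ κ {Δ' Δ : Vec SType m} → Δ' ≤ᴺ Δ → (κ ∷ Δ') ≤ᴺ (κ ∷ Δ)
≤ᴺ-∷ κ Δ'≤Δ zero    = reflS
≤ᴺ-∷ κ Δ'≤Δ (suc i) = Δ'≤Δ i

⊢-antitone : ∀ {Γ Γ' : Vec TType n} {Δ Δ' : Vec SType m} {M δ} →
  Γ ⊢ M ∶ δ ∣ Δ → Γ' ≤ᴮ Γ → Δ' ≤ᴺ Δ → Γ' ⊢ M ∶ δ ∣ Δ'
⊢-antitone (ax x)               Γ'≤Γ Δ'≤Δ = sub (ax x) (Γ'≤Γ x)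
⊢-antitone (abs {δ = δ} D)      Γ'≤Γ Δ'≤Δ = abs (⊢-antitone D (≤ᴮ-∷ δ Γ'≤Γ) Δ'≤Δ)
⊢-antitone (app D E)            Γ'≤Γ Δ'≤Δ = app (⊢-antitone D Γ'≤Γ Δ'≤Δ) (⊢-antitone E Γ'≤Γ Δ'≤Δ)
⊢-antitone (mu₁ {κ = κ} D)      Γ'≤Γ Δ'≤Δ = mu₁ (⊢-antitone D Γ'≤Γ (≤ᴺ-∷ κ Δ'≤Δ))
⊢-antitone (mu₂ {κ = κ} {β} D)  Γ'≤Γ Δ'≤Δ =
  mu₂ (sub (⊢-antitone D Γ'≤Γ (≤ᴺ-∷ κ Δ'≤Δ)) (contra (Δ'≤Δ β)))
⊢-antitone (sub D δ≤δ')         Γ'≤Γ Δ'≤Δ = sub (⊢-antitone D Γ'≤Γ Δ'≤Δ) δ≤δ'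
⊢-antitone (int D E)            Γ'≤Γ Δ'≤Δ = int (⊢-antitone D Γ'≤Γ Δ'≤Δ) (⊢-antitone E Γ'≤Γ Δ'≤Δ)

_∧ᴮ_ : Vec TType n → Vec TType n → Vec TType n
_∧ᴮ_ = zipWith _∧_

_∧ᴺ_ : Vec SType m → Vec SType m → Vec SType m
_∧ᴺ_ = zipWith _∧ₛ_

∧ᴮ-lowerˡ : (Γ Γ' : Vec TType n) → (Γ ∧ᴮ Γ') ≤ᴮ Γ
∧ᴮ-lowerˡ Γ Γ' i rewrite lookup-zipWith _∧_ i Γ Γ' = ∧-lbT

∧ᴮ-lowerʳ : (Γ Γ' : Vec TType n) → (Γ ∧ᴮ Γ') ≤ᴮ Γ'
∧ᴮ-lowerʳ Γ Γ' i rewrite lookup-zipWith _∧_ i Γ Γ' = ∧-rbT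

∧ᴺ-lowerˡ : (Δ Δ' : Vec SType m) → (Δ ∧ᴺ Δ') ≤ᴺ Δ
∧ᴺ-lowerˡ Δ Δ' i rewrite lookup-zipWith _∧ₛ_ i Δ Δ' = ∧-lbS

∧ᴺ-lowerʳ : (Δ Δ' : Vec SType m) → (Δ ∧ᴺ Δ') ≤ᴺ Δ'
∧ᴺ-lowerʳ Δ Δ' i rewrite lookup-zipWith _∧ₛ_ i Δ Δ' = ∧-rbS

⊢-app-∧ : ∀ {Γ₁ Γ₂ : Vec TType n} {Δ₁ Δ₂ : Vec SType m} {M N δ ρ} →
  Γ₁ ⊢ M ∶ ⌜ δ ×ₛ ρ ⌝ ⇒ν ∣ Δ₁ → Γ₂ ⊢ N ∶ δ ∣ Δ₂ →
  (Γ₁ ∧ᴮ Γ₂) ⊢ app M N ∶ ρ ⇒ν ∣ (Δ₁ ∧ᴺ Δ₂)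
⊢-app-∧ {Γ₁ = Γ₁} {Γ₂} {Δ₁} {Δ₂} D E =
  app (⊢-antitone D (∧ᴮ-lowerˡ Γ₁ Γ₂) (∧ᴺ-lowerˡ Δ₁ Δ₂))
      (⊢-antitone E (∧ᴮ-lowerʳ Γ₁ Γ₂) (∧ᴺ-lowerʳ Δ₁ Δ₂))

_∧ᴺ·_ : Vec SType m → SType → Vec SType m
Δ ∧ᴺ· κ = map (_∧ₛ κ) Δ

∧ᴺ·-lower : (Δ : Vec SType m) (κ : SType) → (Δ ∧ᴺ· κ) ≤ᴺ Δ
∧ᴺ·-lower Δ κ i rewrite lookup-map i (_∧ₛ κ) Δ = ∧-lbS

lookup-∧ᴺ·-≤ : (Δ : Vec SType m) (κ : SType) (γ : Fin m) → lookup (Δ ∧ᴺ· κ) γ ≤S κ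
lookup-∧ᴺ·-≤ Δ κ γ rewrite lookup-map γ (_∧ₛ κ) Δ = ∧-rbS

⊢-retarget : ∀ {Γ : Vec TType n} {Δ : Vec SType m} {M κ} →
  Γ ⊢ M ∶ ⌜ κ ⌝ ⇒ν ∣ Δ → (γ : Fin m) →
  Γ ⊢ M ∶ ⌜ lookup (Δ ∧ᴺ· κ) γ ⌝ ⇒ν ∣ (Δ ∧ᴺ· κ)
⊢-retarget {Γ = Γ} {Δ} {κ = κ} D γ =
  sub (⊢-antitone D (≤ᴮ-refl Γ) (∧ᴺ·-lower Δ κ)) (contra (lookup-∧ᴺ·-≤ Δ κ γ))

⊢-var-replicate : ∀ (x : Fin n) δ (Δ : Vec SType m) → replicate n δ ⊢ var x ∶ δ ∣ Δ
⊢-var-replicate {n} x δ Δ = subst (λ δ' → replicate n δ ⊢ var x ∶ δ' ∣ Δ) (lookup-replicate x δ) (ax x)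

mutual
  neutral-typable : {M : Term n m} → Neutral M → (ρ : SO) →
    ∃[ Γ ] ∃[ Δ ] (Γ ⊢ M ∶ ρ ⇒ν ∣ Δ)
  neutral-typable {m = m} (var x) ρ =
    _ , replicate m (ν ×ₛ ω) , ⊢-var-replicate x (ρ ⇒ν) _
  neutral-typable (app neM nfN) ρ with normal-typable nfN
  ... | Γ₂ , Δ₂ , κ , E with neutral-typable neM ⌜ (⌜ κ ⌝ ⇒ν) ×ₛ ρ ⌝
  ... | Γ₁ , Δ₁ , D = Γ₁ ∧ᴮ Γ₂ , Δ₁ ∧ᴺ Δ₂ , ⊢-app-∧ D E

  normal-typable : {M : Term n m} → Normal M →
    ∃[ Γ ] ∃[ Δ ] ∃[ κ ] (Γ ⊢ M ∶ ⌜ κ ⌝ ⇒ν ∣ Δ)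
  normal-typable (ne neM) with neutral-typable neM ⌜ ν ×ₛ ω ⌝
  ... | Γ , Δ , D = Γ , Δ , ν ×ₛ ω , D
  normal-typable (lam nfM) with normal-typable nfM
  ... | δ ∷ Γ , Δ , κ , D = Γ , Δ , δ ×ₛ ⌜ κ ⌝ , abs D
  normal-typable (mu {β = zero} nfM) with normal-typable nfM
  ... | Γ , κ' ∷ Δ , κ , D = Γ , Δ ∧ᴺ· κ , κ' ∧ₛ κ , mu₁ (⊢-retarget D zero)
  normal-typable (mu {β = suc β} nfM) with normal-typable nfM
  ... | Γ , κ' ∷ Δ , κ , D = Γ , Δ ∧ᴺ· κ , κ' ∧ₛ κ , mu₂ (⊢-retarget D (suc β))

lemma2p20 : ∀ {n m : ℕ} (N : Term n m) → Normal N →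
    ∃[ Γ ] ∃[ Δ ] ∃[ κ ] (Γ ⊢ N ∶ ⌜ κ ⌝ ⇒ν ∣ Δ)
lemma2p20 N nfN = normal-typable nfN
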